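{- Let $\varphi$ be a quantifier-free $\mathcal{T}$-formula which is $\mathcal{T}$-extended with respect to a finite set of atoms $\boldsymbol{\alpha}$ containing its atoms, and let $l$ be a literal on $\boldsymbol{\alpha}$. Then $l\models_{\mathcal{T}}\varphi$ if and only if $l\models_p\varphi$.
   Context: $\mathcal{T}$-formulas are quantifier-free formulas built by Boolean connectives from $\mathcal{T}$-atoms and Boolean atoms. $\models_{\mathcal{T}}$ is entailment modulo $\mathcal{T}$; $\psi\models_p\chi$ means the Boolean abstraction (atoms mapped bijectively to Boolean variables) of $\psi$ propositionally entails that of $\chi$. A total truth assignment on $\boldsymbol{\alpha}$ is a conjunction containing, for each $a\in\boldsymbol{\alpha}$, exactly one of $a,\neg a$. $P_{\boldsymbol{\alpha}}(\psi)$ is the set of $\mathcal{T}$-unsatisfiable total truth assignments $\rho$ on $\boldsymbol{\alpha}$ with $\rho\models_p\psi$; $\psi$ is $\mathcal{T}$-extended with respect to $\boldsymbol{\alpha}$ iff $P_{\boldsymbol{\alpha}}(\neg\psi)=\emptyset$. -}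

module Defs where

open import Data.Nat using (ℕ)
open import Data.Fin using (Fin)
open import Data.Bool using (Bool; true; false; not; _∧_; _∨_; if_then_else_)
open import Data.List using (foldr)
open import Data.List.Base using (allFin)
open import Data.Product using (Σ; _×_)
open import Relation.Binary.PropositionalEquality using (_≡_)
open import Relation.Nullary using (¬_)

-- Quantifier-free formulas over the atom set α = Fin n
-- (atoms are T-atoms or Boolean atoms; they are all treated as atoms).
data Formula (n : ℕ) : Set where
  atom : Fin n → Formula n
  ⊤f ⊥f : Formula n
  ¬f_ : Formula n → Formula n
  _∧f_ _∨f_ _⇒f_ _⇔f_ : Formula n → Formula n → Formula n

⟦_⟧ : ∀ {n} → Formula n → (Fin n → Bool) → Bool
⟦ atom i ⟧ μ = μ i
⟦ ⊤f ⟧ μ = true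
⟦ ⊥f ⟧ μ = false
⟦ ¬f φ ⟧ μ = not (⟦ φ ⟧ μ)
⟦ φ ∧f ψ ⟧ μ = ⟦ φ ⟧ μ ∧ ⟦ ψ ⟧ μ
⟦ φ ∨f ψ ⟧ μ = ⟦ φ ⟧ μ ∨ ⟦ ψ ⟧ μ
⟦ φ ⇒f ψ ⟧ μ = not (⟦ φ ⟧ μ) ∨ ⟦ ψ ⟧ μ
⟦ φ ⇔f ψ ⟧ μ = if ⟦ φ ⟧ μ then ⟦ ψ ⟧ μ else not (⟦ ψ ⟧ μ)

-- A theory T, abstractly: a collection of T-interpretations, each
-- assigning a truth value to every atom.
record Theory (n : ℕ) : Set₁ where
  field
    Model : Set
    val   : Model → Fin n → Bool

_⊨[_]_ : ∀ {n} → Formula n → Theory n → Formula n → Set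
ψ ⊨[ T ] χ = (M : Theory.Model T) →
  ⟦ ψ ⟧ (Theory.val T M) ≡ true → ⟦ χ ⟧ (Theory.val T M) ≡ true

T-satisfiable : ∀ {n} → Theory n → Formula n → Set
T-satisfiable T ψ = Σ (Theory.Model T) λ M → ⟦ ψ ⟧ (Theory.val T M) ≡ true

-- Propositional entailment of Boolean abstractions (atoms are already
-- Boolean variables Fin n; abstraction is the identity bijection).
_⊨p_ : ∀ {n} → Formula n → Formula n → Set
_⊨p_ {n} ψ χ = (μ : Fin n → Bool) → ⟦ ψ ⟧ μ ≡ true → ⟦ χ ⟧ μ ≡ true

data Literal (n : ℕ) : Set where
  pos neg : Fin n → Literal n

litF : ∀ {n} → Literal n → Formula n
litF (pos i) = atom i
litF (neg i) = ¬f atom i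

-- Total truth assignment on α: for each atom a, exactly one of a, ¬a.
-- Represented by the choice ρ : Fin n → Bool, and as the conjunction formula.
TotalAssignment : ℕ → Set
TotalAssignment n = Fin n → Bool

assignF : ∀ {n} → TotalAssignment n → Formula n
assignF {n} ρ =
  foldr (λ i acc → (if ρ i then atom i else ¬f atom i) ∧f acc) ⊤f (allFin n)

InP : ∀ {n} → Theory n → Formula n → TotalAssignment n → Set
InP T ψ ρ = (¬ T-satisfiable T (assignF ρ)) × (assignF ρ ⊨p ψ)

T-extended : ∀ {n} → Theory n → Formula n → Set
T-extended {n} T ψ = (ρ : TotalAssignment n) → ¬ InP T (¬f ψ) ρ

-- A total truth assignment ρ has ρ itself as its only propositional model, so it
-- propositionally entails ¬φ exactly when ρ falsifies φ. T-extendedness then makes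
-- every such ρ T-satisfiable, and a T-model of ρ evaluates every formula as ρ does.
-- Hence a T-entailment ψ ⊨_T φ can never be refuted by a Boolean assignment, which
-- is propositional entailment; the converse holds for any theory.
module Submission where

open import Defs
open import Data.Nat using (ℕ)
open import Data.Fin using (Fin)
open import Data.Bool using (Bool; true; false; not; _∧_; _∨_; if_then_else_)
open import Data.Bool.Properties using (∧-conicalˡ; ∧-conicalʳ; not-injective)
open import Data.List using (List; []; _∷_; foldr; allFin)
open import Data.List.Relation.Unary.All using (All; []; _∷_; lookup)
open import Data.List.Membership.Propositional.Properties using (∈-allFin)
open import Data.Product using (_,_)
open import Data.Empty using (⊥-elim)
open import Function.Bundles using (_⇔_; mk⇔)
open import Relation.Binary.PropositionalEquality
  using (_≡_; _≗_; refl; sym; trans; cong; cong₂; module ≡-Reasoning)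
open import Relation.Nullary using (¬_)

⟦⟧-cong : ∀ {n} (φ : Formula n) {μ ν : Fin n → Bool} → μ ≗ ν → ⟦ φ ⟧ μ ≡ ⟦ φ ⟧ ν
⟦⟧-cong (atom i)  μ≗ν = μ≗ν i
⟦⟧-cong ⊤f        μ≗ν = refl
⟦⟧-cong ⊥f        μ≗ν = refl
⟦⟧-cong (¬f φ)    μ≗ν = cong not (⟦⟧-cong φ μ≗ν)
⟦⟧-cong (φ ∧f ψ)  μ≗ν = cong₂ _∧_ (⟦⟧-cong φ μ≗ν) (⟦⟧-cong ψ μ≗ν)
⟦⟧-cong (φ ∨f ψ)  μ≗ν = cong₂ _∨_ (⟦⟧-cong φ μ≗ν) (⟦⟧-cong ψ μ≗ν)
⟦⟧-cong (φ ⇒f ψ)  μ≗ν = cong₂ (λ a b → not a ∨ b) (⟦⟧-cong φ μ≗ν) (⟦⟧-cong ψ μ≗ν)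
⟦⟧-cong (φ ⇔f ψ)  μ≗ν =
  cong₂ (λ a b → if a then b else not b) (⟦⟧-cong φ μ≗ν) (⟦⟧-cong ψ μ≗ν)

module _ {n : ℕ} (ρ : TotalAssignment n) where

  assignedLiteral : Fin n → Formula n
  assignedLiteral i = if ρ i then atom i else ¬f atom i

  assignedLiteral-true⇒agrees : ∀ {ν} i → ⟦ assignedLiteral i ⟧ ν ≡ true → ν i ≡ ρ i
  assignedLiteral-true⇒agrees i holds with ρ i
  ... | true  = holds
  ... | false = not-injective holds

  assignOn-true⇒agrees : ∀ {ν} (is : List (Fin n)) →
    ⟦ foldr (λ i acc → assignedLiteral i ∧f acc) ⊤f is ⟧ ν ≡ true →
    All (λ i → ν i ≡ ρ i) is
  assignOn-true⇒agrees []       _     = []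
  assignOn-true⇒agrees (i ∷ is) holds =
    assignedLiteral-true⇒agrees i (∧-conicalˡ _ _ holds)
      ∷ assignOn-true⇒agrees is (∧-conicalʳ _ _ holds)

  assignF-true⇒≗ : ∀ {ν} → ⟦ assignF ρ ⟧ ν ≡ true → ν ≗ ρ
  assignF-true⇒≗ holds i = lookup (assignOn-true⇒agrees (allFin n) holds) (∈-allFin i)

  assignF-true⇒⟦⟧≡ : ∀ {ν} (χ : Formula n) → ⟦ assignF ρ ⟧ ν ≡ true → ⟦ χ ⟧ ν ≡ ⟦ χ ⟧ ρ
  assignF-true⇒⟦⟧≡ χ holds = ⟦⟧-cong χ (assignF-true⇒≗ holds)

  assignF-⊨p-¬ : ∀ φ → ⟦ φ ⟧ ρ ≡ false → assignF ρ ⊨p (¬f φ)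
  assignF-⊨p-¬ φ φρ ν holds = cong not (trans (assignF-true⇒⟦⟧≡ φ holds) φρ)

module _ {n : ℕ} (T : Theory n) (ψ φ : Formula n) where
  open Theory T

  ⊨p⇒⊨T : ψ ⊨p φ → ψ ⊨[ T ] φ
  ⊨p⇒⊨T ψ⊨pφ M = ψ⊨pφ (val M)

  satisfiable-assignF-transfers-⊨T : ∀ {μ} → ψ ⊨[ T ] φ → ⟦ ψ ⟧ μ ≡ true →
    T-satisfiable T (assignF μ) → ⟦ φ ⟧ μ ≡ true
  satisfiable-assignF-transfers-⊨T {μ} ψ⊨Tφ ψμ (M , Mμ) = begin
    ⟦ φ ⟧ μ       ≡⟨ assignF-true⇒⟦⟧≡ μ φ Mμ ⟨
    ⟦ φ ⟧ (val M) ≡⟨ ψ⊨Tφ M (trans (assignF-true⇒⟦⟧≡ μ ψ Mμ) ψμ) ⟩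
    true          ∎
    where open ≡-Reasoning

  T-extended⇒⊨T⇒⊨p : T-extended T φ → ψ ⊨[ T ] φ → ψ ⊨p φ
  T-extended⇒⊨T⇒⊨p extended ψ⊨Tφ μ ψμ with ⟦ φ ⟧ μ in φμ
  ... | true  = refl
  ... | false = ⊥-elim (extended μ (unsatisfiable , assignF-⊨p-¬ μ φ φμ))
    where
    unsatisfiable : ¬ T-satisfiable T (assignF μ)
    unsatisfiable sat
      with () ← trans (sym φμ) (satisfiable-assignF-transfers-⊨T ψ⊨Tφ ψμ sat)

lemmaA5 : (n : ℕ) (T : Theory n) (φ : Formula n) →
    T-extended T φ → (l : Literal n) →
    (litF l ⊨[ T ] φ) ⇔ (litF l ⊨p φ)
lemmaA5 n T φ extended l = mk⇔ (T-extended⇒⊨T⇒⊨p T (litF l) φ extended) (⊨p⇒⊨T T (litF l) φ)
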